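{- Let $(A_S,\partial)$ be a semi-free dg-algebra over a unital ring $R$ with stabilization $(A_{S^+},\partial^+)$, and assume every generator in $S^+$ (hence in $S$) has strictly positive degree. Then for every positive integer $r$ and every field $\mathbb{F}$, pullback along the stabilization dg-homomorphism $i\colon A_S\to A_{S^+}$ and the destabilization dg-homomorphism $\pi\colon A_{S^+}\to A_S$ give mutually inverse bijections $\mathrm{Rep}_r(A_S,\partial;\mathbb{F})\cong\mathrm{Rep}_r(A_{S^+},\partial^+;\mathbb{F})$.
   Context: A semi-free graded algebra is $A_S=R*\mathbb{Z}\langle S\rangle$, the fully non-commutative graded algebra freely generated by $R$ (degree $0$) and a set $S$ of generators with non-negative degrees; a semi-free dg-algebra carries a degree $-1$ differential satisfying the Leibniz rule and $\partial^2=0$. The stabilization of $(A_S,\partial)$ is $(A_{S^+},\partial^+)$ with $S^+=S\sqcup\{x,y\}$, $\deg y=\deg x+1$, $\partial^+=\partial$ on $S$, $\partial^+y=x$, $\partial^+x=0$; the stabilization dg-homomorphism is the inclusion $i\colon A_S\hookrightarrow A_{S^+}$, and the destabilization dg-homomorphism $\pi\colon A_{S^+}\to A_S$ kills $x,y$ and is the identity on $R$ and $S$. For a field $\mathbb{F}$, a rank $r$ representation of a dg-algebra $(A,\partial)$ over $\mathbb{F}$ is a dg-homomorphism $(A,\partial)\to(\mathrm{Mat}_r(\mathbb{F}),0)$, where $\mathrm{Mat}_r(\mathbb{F})$ is concentrated in degree $0$ with zero differential; $\mathrm{Rep}_r(A,\partial;\mathbb{F})$ denotes the set of these. A dg-homomorphism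 $\Phi\colon A\to B$ induces the pullback $\Phi^*\colon\mathrm{Rep}_r(B)\to\mathrm{Rep}_r(A)$, $\epsilon\mapsto\epsilon\circ\Phi$. -}

module Defs where

open import Level using (Level; _⊔_) renaming (suc to lsuc)
open import Data.Nat using (ℕ; zero; suc; _+_)
open import Data.Fin using (Fin; zero; suc)
open import Data.Sum using (_⊎_; inj₁; inj₂)
open import Data.Product using (Σ; _×_; ∃)
open import Relation.Nullary using (¬_)
open import Algebra.Bundles using (Ring; CommutativeRing)

record Field (c ℓ : Level) : Set (lsuc (c ⊔ ℓ)) where
  field
    commutativeRing : CommutativeRing c ℓ
  open CommutativeRing commutativeRing public
  field
    0≉1     : ¬ (0# ≈ 1#)
    inverse : ∀ x → ¬ (x ≈ 0#) → ∃ λ y → x * y ≈ 1#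

-- The semi-free graded algebra A_S = R * Z⟨S⟩ : terms of the free
-- (non-commutative, unital) ring generated by the elements of R and by
-- the symbols of S, modulo the ring axioms and the relations of R
-- (i.e. the coproduct of R and the free ring Z⟨S⟩ in unital rings).

module _ {c ℓ : Level} (R : Ring c ℓ) where
  private module R = Ring R

  infixl 6 _⊕_
  infixl 7 _⊗_
  infix  4 _≈ₜ_

  data Tm {s : Level} (S : Set s) : Set (c ⊔ s) where
    cst : R.Carrier → Tm S
    gen : S → Tm S
    _⊕_ : Tm S → Tm S → Tm S
    _⊗_ : Tm S → Tm S → Tm S
    ⊖_  : Tm S → Tm S
    𝟘   : Tm S
    𝟙   : Tm S

  data _≈ₜ_ {s : Level} {S : Set s} : Tm S → Tm S → Set (c ⊔ ℓ ⊔ s) where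
    ≈-refl  : ∀ {a} → a ≈ₜ a
    ≈-sym   : ∀ {a b} → a ≈ₜ b → b ≈ₜ a
    ≈-trans : ∀ {a b d} → a ≈ₜ b → b ≈ₜ d → a ≈ₜ d
    ⊕-cong  : ∀ {a a′ b b′} → a ≈ₜ a′ → b ≈ₜ b′ → a ⊕ b ≈ₜ a′ ⊕ b′
    ⊗-cong  : ∀ {a a′ b b′} → a ≈ₜ a′ → b ≈ₜ b′ → a ⊗ b ≈ₜ a′ ⊗ b′
    ⊖-cong  : ∀ {a a′} → a ≈ₜ a′ → ⊖ a ≈ₜ ⊖ a′
    ⊕-assoc     : ∀ a b d → (a ⊕ b) ⊕ d ≈ₜ a ⊕ (b ⊕ d)
    ⊕-comm      : ∀ a b → a ⊕ b ≈ₜ b ⊕ a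
    ⊕-identityˡ : ∀ a → 𝟘 ⊕ a ≈ₜ a
    ⊖-inverseˡ  : ∀ a → (⊖ a) ⊕ a ≈ₜ 𝟘
    ⊗-assoc     : ∀ a b d → (a ⊗ b) ⊗ d ≈ₜ a ⊗ (b ⊗ d)
    ⊗-identityˡ : ∀ a → 𝟙 ⊗ a ≈ₜ a
    ⊗-identityʳ : ∀ a → a ⊗ 𝟙 ≈ₜ a
    distribˡ    : ∀ a b d → a ⊗ (b ⊕ d) ≈ₜ (a ⊗ b) ⊕ (a ⊗ d)
    distribʳ    : ∀ a b d → (b ⊕ d) ⊗ a ≈ₜ (b ⊗ a) ⊕ (d ⊗ a)
    cst-cong : ∀ {x y} → x R.≈ y → cst x ≈ₜ cst y
    cst-+    : ∀ x y → cst (x R.+ y) ≈ₜ cst x ⊕ cst y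
    cst-*    : ∀ x y → cst (x R.* y) ≈ₜ cst x ⊗ cst y
    cst-1    : cst R.1# ≈ₜ 𝟙

  -- Grading: HasDeg deg a d means the term a is (syntactically)
  -- homogeneous of degree d; R has degree 0, a generator s has degree deg s.
  data HasDeg {s : Level} {S : Set s} (deg : S → ℕ) : Tm S → ℕ → Set (c ⊔ s) where
    deg-cst : ∀ x → HasDeg deg (cst x) 0
    deg-gen : ∀ g → HasDeg deg (gen g) (deg g)
    deg-𝟘   : ∀ d → HasDeg deg 𝟘 d
    deg-𝟙   : HasDeg deg 𝟙 0
    deg-⊕   : ∀ {a b d} → HasDeg deg a d → HasDeg deg b d → HasDeg deg (a ⊕ b) d
    deg-⊖   : ∀ {a d} → HasDeg deg a d → HasDeg deg (⊖ a) d
    deg-⊗   : ∀ {a b d e} → HasDeg deg a d → HasDeg deg b e → HasDeg deg (a ⊗ b) (d + e)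

  sgn : {s : Level} {S : Set s} → ℕ → Tm S
  sgn zero    = 𝟙
  sgn (suc n) = ⊖ sgn n

  record IsDifferential {s : Level} {S : Set s} (deg : S → ℕ)
                        (∂ : Tm S → Tm S) : Set (c ⊔ ℓ ⊔ s) where
    field
      ∂-cong    : ∀ {a b} → a ≈ₜ b → ∂ a ≈ₜ ∂ b
      ∂-+       : ∀ a b → ∂ (a ⊕ b) ≈ₜ ∂ a ⊕ ∂ b
      ∂-leibniz : ∀ {a d} → HasDeg deg a d → ∀ b →
                  ∂ (a ⊗ b) ≈ₜ (∂ a ⊗ b) ⊕ (sgn d ⊗ (a ⊗ ∂ b))
      ∂-deg0    : ∀ {a} → HasDeg deg a 0 → ∂ a ≈ₜ 𝟘
      ∂-deg     : ∀ {a d} → HasDeg deg a (suc d) →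
                  Σ (Tm S) λ b → HasDeg deg b d × (∂ a ≈ₜ b)
      ∂²        : ∀ a → ∂ (∂ a) ≈ₜ 𝟘

  data XY : Set where
    gx gy : XY

  deg⁺ : {s : Level} {S : Set s} → (S → ℕ) → ℕ → S ⊎ XY → ℕ
  deg⁺ deg dx (inj₁ g)  = deg g
  deg⁺ deg dx (inj₂ gx) = dx
  deg⁺ deg dx (inj₂ gy) = suc dx

  incl : {s : Level} {S : Set s} → Tm S → Tm (S ⊎ XY)
  incl (cst x) = cst x
  incl (gen g) = gen (inj₁ g)
  incl (a ⊕ b) = incl a ⊕ incl b
  incl (a ⊗ b) = incl a ⊗ incl b
  incl (⊖ a)   = ⊖ incl a
  incl 𝟘       = 𝟘
  incl 𝟙       = 𝟙

  proj : {s : Level} {S : Set s} → Tm (S ⊎ XY) → Tm S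
  proj (cst x)         = cst x
  proj (gen (inj₁ g))  = gen g
  proj (gen (inj₂ _))  = 𝟘
  proj (a ⊕ b)         = proj a ⊕ proj b
  proj (a ⊗ b)         = proj a ⊗ proj b
  proj (⊖ a)           = ⊖ proj a
  proj 𝟘               = 𝟘
  proj 𝟙               = 𝟙

  record IsStabilization {s : Level} {S : Set s} (deg : S → ℕ) (dx : ℕ)
                         (∂ : Tm S → Tm S) (∂⁺ : Tm (S ⊎ XY) → Tm (S ⊎ XY))
                         : Set (c ⊔ ℓ ⊔ s) where
    field
      isDifferential⁺ : IsDifferential (deg⁺ deg dx) ∂⁺
      ∂⁺-S : ∀ g → ∂⁺ (gen (inj₁ g)) ≈ₜ incl (∂ (gen g))
      ∂⁺-y : ∂⁺ (gen (inj₂ gy)) ≈ₜ gen (inj₂ gx)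
      ∂⁺-x : ∂⁺ (gen (inj₂ gx)) ≈ₜ 𝟘

module _ {f ℓf : Level} (F : Field f ℓf) where
  private module F = Field F

  Mat : ℕ → Set f
  Mat r = Fin r → Fin r → F.Carrier

  Σᶠ : ∀ {n} → (Fin n → F.Carrier) → F.Carrier
  Σᶠ {zero}  v = F.0#
  Σᶠ {suc n} v = v zero F.+ Σᶠ (λ i → v (suc i))

  _≈M_ : ∀ {r} → Mat r → Mat r → Set ℓf
  A ≈M B = ∀ i j → A i j F.≈ B i j

  _+M_ : ∀ {r} → Mat r → Mat r → Mat r
  (A +M B) i j = A i j F.+ B i j

  _*M_ : ∀ {r} → Mat r → Mat r → Mat r
  (A *M B) i j = Σᶠ (λ k → A i k F.* B k j)

  0M : ∀ {r} → Mat r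
  0M i j = F.0#

  1M : ∀ {r} → Mat r
  1M i j with Data.Fin._≟_ i j
  ... | Relation.Nullary.yes _ = F.1#
  ... | Relation.Nullary.no  _ = F.0#

-- Rank r representations: dg-homomorphisms (A_S, ∂) → (Mat_r(F), 0),
-- i.e. unital ring homomorphisms that preserve degree (so kill all
-- homogeneous elements of nonzero degree) and satisfy ε ∘ ∂ = 0.

module _ {c ℓ : Level} (R : Ring c ℓ) {f ℓf : Level} (F : Field f ℓf) (r : ℕ) where

  record IsRep {s : Level} {S : Set s} (deg : S → ℕ) (∂ : Tm R S → Tm R S)
               (ε : Tm R S → Mat F r) : Set (c ⊔ ℓ ⊔ s ⊔ ℓf) where
    field
      ε-cong : ∀ {a b} → _≈ₜ_ R a b → _≈M_ F (ε a) (ε b)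
      ε-+    : ∀ a b → _≈M_ F (ε (a ⊕ b)) (_+M_ F (ε a) (ε b))
      ε-*    : ∀ a b → _≈M_ F (ε (a ⊗ b)) (_*M_ F (ε a) (ε b))
      ε-1    : _≈M_ F (ε 𝟙) (1M F)
      ε-deg  : ∀ {a d} → HasDeg R deg a (suc d) → _≈M_ F (ε a) (0M F)
      ε-∂    : ∀ a → _≈M_ F (ε (∂ a)) (0M F)

  record StabRepBijection {s : Level} {S : Set s} (deg : S → ℕ) (dx : ℕ)
                          (∂ : Tm R S → Tm R S)
                          (∂⁺ : Tm R (S ⊎ XY R) → Tm R (S ⊎ XY R))
                          : Set (c ⊔ lsuc ℓ ⊔ s ⊔ f ⊔ lsuc ℓf) where
    field
      i*-rep : ∀ ε → IsRep (deg⁺ R deg dx) ∂⁺ ε → IsRep deg ∂ (λ a → ε (incl R a))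
      π*-rep : ∀ ε → IsRep deg ∂ ε → IsRep (deg⁺ R deg dx) ∂⁺ (λ a → ε (proj R a))
      i*π*≡id : ∀ ε → IsRep deg ∂ ε →
                ∀ a → _≈M_ F (ε (proj R (incl R a))) (ε a)
      π*i*≡id : ∀ ε → IsRep (deg⁺ R deg dx) ∂⁺ ε →
                ∀ a → _≈M_ F (ε (incl R (proj R a))) (ε a)

{-# OPTIONS --safe #-}
-- A representation ε of A_{S⁺} lands in degree 0, so it kills the positive-degree generators
-- x and y; hence ε factors through π, i.e. ε ∘ i ∘ π = ε, while π ∘ i = id on the nose.
-- That ε ∘ i and ε ∘ π are again representations reduces, via the Leibniz rule, to ε ∘ ∂
-- vanishing on generators, which follows from ∂⁺ = ∂ on S, ∂⁺ y = x and ∂⁺ x = 0.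
module Submission where

open import Defs
open import Level using (Level; _⊔_)
open import Function using (_∘_; id)
open import Data.Nat using (ℕ; _≤_; suc; s≤s)
open import Data.Fin using (Fin; zero; suc)
open import Data.Sum using (_⊎_; inj₁; inj₂; [_,_])
open import Algebra.Bundles using (Ring; AbelianGroup)
open import Relation.Binary.PropositionalEquality as ≡ using (_≗_)
import Algebra.Construct.Pointwise as Pointwise
import Algebra.Properties.AbelianGroup as AbelianGroupProperties
import Relation.Binary.Reasoning.Setoid as SetoidReasoning

module MatrixProperties {f ℓf : Level} (F : Field f ℓf) where
  private module F = Field F

  infix  4 _≋_
  infixl 6 _+ᴹ_
  infixl 7 _*ᴹ_

  _≋_ : ∀ {r} → Mat F r → Mat F r → Set ℓf
  _≋_ = _≈M_ F

  _+ᴹ_ _*ᴹ_ : ∀ {r} → Mat F r → Mat F r → Mat F r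
  _+ᴹ_ = _+M_ F
  _*ᴹ_ = _*M_ F

  0ᴹ 1ᴹ : ∀ {r} → Mat F r
  0ᴹ = 0M F
  1ᴹ = 1M F

  Σᶠ-cong : ∀ {n} {v w : Fin n → F.Carrier} → (∀ i → v i F.≈ w i) → Σᶠ F v F.≈ Σᶠ F w
  Σᶠ-cong {ℕ.zero} eq = F.refl
  Σᶠ-cong {suc n}  eq = F.+-cong (eq zero) (Σᶠ-cong (eq ∘ suc))

  Σᶠ-0 : ∀ n → Σᶠ F {n} (λ _ → F.0#) F.≈ F.0#
  Σᶠ-0 ℕ.zero  = F.refl
  Σᶠ-0 (suc n) = F.trans (F.+-cong F.refl (Σᶠ-0 n)) (F.+-identityˡ F.0#)

  -- Its equality, sum and zero are definitionally _≋_, _+ᴹ_ and 0ᴹ.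
  +ᴹ-abelianGroup : ℕ → AbelianGroup f ℓf
  +ᴹ-abelianGroup r =
    Pointwise.abelianGroup (Fin r) (Pointwise.abelianGroup (Fin r) F.+-abelianGroup)

  module _ {r : ℕ} where
    open AbelianGroup (+ᴹ-abelianGroup r) public
      using ()
      renaming ( setoid to ≋-setoid; refl to ≋-refl; reflexive to ≋-reflexive; sym to ≋-sym; trans to ≋-trans
               ; ∙-cong to +ᴹ-cong; identityˡ to +ᴹ-identityˡ
               ; _⁻¹ to -ᴹ_; ⁻¹-cong to -ᴹ-cong)
    open AbelianGroupProperties (+ᴹ-abelianGroup r) public
      using ()
      renaming (inverseˡ-unique to +ᴹ-inverseˡ-unique; ε⁻¹≈ε to -ᴹ0ᴹ≋0ᴹ)

    *ᴹ-cong : {A A′ B B′ : Mat F r} → A ≋ A′ → B ≋ B′ → A *ᴹ B ≋ A′ *ᴹ B′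
    *ᴹ-cong A≋A′ B≋B′ i j = Σᶠ-cong (λ k → F.*-cong (A≋A′ i k) (B≋B′ k j))

    *ᴹ-zeroˡ : (B : Mat F r) → 0ᴹ *ᴹ B ≋ 0ᴹ
    *ᴹ-zeroˡ B i j = F.trans (Σᶠ-cong (λ k → F.zeroˡ (B k j))) (Σᶠ-0 r)

    *ᴹ-zeroʳ : (A : Mat F r) → A *ᴹ 0ᴹ ≋ 0ᴹ
    *ᴹ-zeroʳ A i j = F.trans (Σᶠ-cong (λ k → F.zeroʳ (A i k))) (Σᶠ-0 r)

    A+B≋0∧B≋0⇒A≋0 : {A B : Mat F r} → A +ᴹ B ≋ 0ᴹ → B ≋ 0ᴹ → A ≋ 0ᴹ
    A+B≋0∧B≋0⇒A≋0 {A} {B} A+B≋0 B≋0 = begin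
      A       ≈⟨ +ᴹ-inverseˡ-unique A B A+B≋0 ⟩
      -ᴹ B    ≈⟨ -ᴹ-cong B≋0 ⟩
      -ᴹ 0ᴹ   ≈⟨ -ᴹ0ᴹ≋0ᴹ ⟩
      0ᴹ      ∎
      where open SetoidReasoning ≋-setoid

module FreeAlgebra {c ℓ : Level} (R : Ring c ℓ) where
  infix 4 _≃_

  _≃_ : ∀ {s} {S : Set s} → Tm R S → Tm R S → Set _
  _≃_ = _≈ₜ_ R

  bind : ∀ {s t} {S : Set s} {T : Set t} → (S → Tm R T) → Tm R S → Tm R T
  bind σ (cst x) = cst x
  bind σ (gen g) = σ g
  bind σ (a ⊕ b) = bind σ a ⊕ bind σ b
  bind σ (a ⊗ b) = bind σ a ⊗ bind σ b
  bind σ (⊖ a)   = ⊖ bind σ a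
  bind σ 𝟘       = 𝟘
  bind σ 𝟙       = 𝟙

  module _ {s t} {S : Set s} {T : Set t} (σ : S → Tm R T) where
    bind-cong : ∀ {a b} → a ≃ b → bind σ a ≃ bind σ b
    bind-cong ≈-refl             = ≈-refl
    bind-cong (≈-sym p)          = ≈-sym (bind-cong p)
    bind-cong (≈-trans p q)      = ≈-trans (bind-cong p) (bind-cong q)
    bind-cong (⊕-cong p q)       = ⊕-cong (bind-cong p) (bind-cong q)
    bind-cong (⊗-cong p q)       = ⊗-cong (bind-cong p) (bind-cong q)
    bind-cong (⊖-cong p)         = ⊖-cong (bind-cong p)
    bind-cong (⊕-assoc a b d)    = ⊕-assoc _ _ _
    bind-cong (⊕-comm a b)       = ⊕-comm _ _
    bind-cong (⊕-identityˡ a)    = ⊕-identityˡ _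
    bind-cong (⊖-inverseˡ a)     = ⊖-inverseˡ _
    bind-cong (⊗-assoc a b d)    = ⊗-assoc _ _ _
    bind-cong (⊗-identityˡ a)    = ⊗-identityˡ _
    bind-cong (⊗-identityʳ a)    = ⊗-identityʳ _
    bind-cong (distribˡ a b d)   = distribˡ _ _ _
    bind-cong (distribʳ a b d)   = distribʳ _ _ _
    bind-cong (cst-cong p)       = cst-cong p
    bind-cong (cst-+ x y)        = cst-+ x y
    bind-cong (cst-* x y)        = cst-* x y
    bind-cong cst-1              = cst-1

    bind-deg : {degS : S → ℕ} {degT : T → ℕ} → (∀ g → HasDeg R degT (σ g) (degS g)) →
               ∀ {a d} → HasDeg R degS a d → HasDeg R degT (bind σ a) d
    bind-deg σ-deg (deg-cst x) = deg-cst x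
    bind-deg σ-deg (deg-gen g) = σ-deg g
    bind-deg σ-deg (deg-𝟘 d)   = deg-𝟘 d
    bind-deg σ-deg deg-𝟙       = deg-𝟙
    bind-deg σ-deg (deg-⊕ p q) = deg-⊕ (bind-deg σ-deg p) (bind-deg σ-deg q)
    bind-deg σ-deg (deg-⊖ p)   = deg-⊖ (bind-deg σ-deg p)
    bind-deg σ-deg (deg-⊗ p q) = deg-⊗ (bind-deg σ-deg p) (bind-deg σ-deg q)

  module _ {s} {S : Set s} where
    incl≗bind : incl R {S = S} ≗ bind (gen ∘ inj₁)
    incl≗bind (cst x) = ≡.refl
    incl≗bind (gen g) = ≡.refl
    incl≗bind (a ⊕ b) = ≡.cong₂ _⊕_ (incl≗bind a) (incl≗bind b)
    incl≗bind (a ⊗ b) = ≡.cong₂ _⊗_ (incl≗bind a) (incl≗bind b)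
    incl≗bind (⊖ a)   = ≡.cong ⊖_ (incl≗bind a)
    incl≗bind 𝟘       = ≡.refl
    incl≗bind 𝟙       = ≡.refl

    proj≗bind : proj R {S = S} ≗ bind [ gen , (λ _ → 𝟘) ]
    proj≗bind (cst x)        = ≡.refl
    proj≗bind (gen (inj₁ g)) = ≡.refl
    proj≗bind (gen (inj₂ g)) = ≡.refl
    proj≗bind (a ⊕ b)        = ≡.cong₂ _⊕_ (proj≗bind a) (proj≗bind b)
    proj≗bind (a ⊗ b)        = ≡.cong₂ _⊗_ (proj≗bind a) (proj≗bind b)
    proj≗bind (⊖ a)          = ≡.cong ⊖_ (proj≗bind a)
    proj≗bind 𝟘              = ≡.refl
    proj≗bind 𝟙              = ≡.refl

    proj∘incl≗id : proj R ∘ incl R {S = S} ≗ id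
    proj∘incl≗id (cst x) = ≡.refl
    proj∘incl≗id (gen g) = ≡.refl
    proj∘incl≗id (a ⊕ b) = ≡.cong₂ _⊕_ (proj∘incl≗id a) (proj∘incl≗id b)
    proj∘incl≗id (a ⊗ b) = ≡.cong₂ _⊗_ (proj∘incl≗id a) (proj∘incl≗id b)
    proj∘incl≗id (⊖ a)   = ≡.cong ⊖_ (proj∘incl≗id a)
    proj∘incl≗id 𝟘       = ≡.refl
    proj∘incl≗id 𝟙       = ≡.refl

  record IsGradedTmHom {s t} {S : Set s} {T : Set t} (degS : S → ℕ) (degT : T → ℕ)
                       (φ : Tm R S → Tm R T) : Set (c ⊔ ℓ ⊔ s ⊔ t) where
    field
      φ-cong : ∀ {a b} → a ≃ b → φ a ≃ φ b
      φ-⊕    : ∀ a b → φ (a ⊕ b) ≃ φ a ⊕ φ b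
      φ-⊗    : ∀ a b → φ (a ⊗ b) ≃ φ a ⊗ φ b
      φ-𝟙    : φ 𝟙 ≃ 𝟙
      φ-deg  : ∀ {a d} → HasDeg R degS a d → HasDeg R degT (φ a) d

  module _ {s t} {S : Set s} {T : Set t} {degS : S → ℕ} {degT : T → ℕ} where
    bind-isGradedTmHom : (σ : S → Tm R T) → (∀ g → HasDeg R degT (σ g) (degS g)) →
                         IsGradedTmHom degS degT (bind σ)
    bind-isGradedTmHom σ σ-deg = record
      { φ-cong = bind-cong σ
      ; φ-⊕    = λ _ _ → ≈-refl
      ; φ-⊗    = λ _ _ → ≈-refl
      ; φ-𝟙    = ≈-refl
      ; φ-deg  = bind-deg σ σ-deg
      }

    IsGradedTmHom-resp-≗ : {φ ψ : Tm R S → Tm R T} → φ ≗ ψ →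
                           IsGradedTmHom degS degT φ → IsGradedTmHom degS degT ψ
    IsGradedTmHom-resp-≗ {φ} {ψ} φ≗ψ hom = record
      { φ-cong = λ {a} {b} p → ≡.subst₂ _≃_ (φ≗ψ a) (φ≗ψ b) (φ-cong p)
      ; φ-⊕    = λ a b → ≡.subst₂ _≃_ (φ≗ψ (a ⊕ b)) (≡.cong₂ _⊕_ (φ≗ψ a) (φ≗ψ b)) (φ-⊕ a b)
      ; φ-⊗    = λ a b → ≡.subst₂ _≃_ (φ≗ψ (a ⊗ b)) (≡.cong₂ _⊗_ (φ≗ψ a) (φ≗ψ b)) (φ-⊗ a b)
      ; φ-𝟙    = ≡.subst (_≃ 𝟙) (φ≗ψ 𝟙) φ-𝟙
      ; φ-deg  = λ {a} {d} h → ≡.subst (λ t → HasDeg R degT t d) (φ≗ψ a) (φ-deg h)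
      }
      where open IsGradedTmHom hom

  module _ {s} {S : Set s} {deg : S → ℕ} {dx : ℕ} where
    incl-isGradedTmHom : IsGradedTmHom deg (deg⁺ R deg dx) (incl R)
    incl-isGradedTmHom =
      IsGradedTmHom-resp-≗ (≡.sym ∘ incl≗bind) (bind-isGradedTmHom _ (deg-gen ∘ inj₁))

    proj-isGradedTmHom : IsGradedTmHom (deg⁺ R deg dx) deg (proj R)
    proj-isGradedTmHom =
      IsGradedTmHom-resp-≗ (≡.sym ∘ proj≗bind) (bind-isGradedTmHom _ σ-deg)
      where
      σ-deg : ∀ g → HasDeg R deg ([ gen , (λ _ → 𝟘) ] g) (deg⁺ R deg dx g)
      σ-deg (inj₁ g) = deg-gen g
      σ-deg (inj₂ t) = deg-𝟘 _

module Representations {c ℓ : Level} (R : Ring c ℓ) {f ℓf : Level} (F : Field f ℓf) (r : ℕ) where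
  open FreeAlgebra R
  open MatrixProperties F

  private
    M : Set f
    M = Mat F r

  record IsGradedHom {s} {S : Set s} (deg : S → ℕ) (ε : Tm R S → M) : Set (c ⊔ ℓ ⊔ s ⊔ ℓf) where
    field
      ε-cong : ∀ {a b} → a ≃ b → ε a ≋ ε b
      ε-+    : ∀ a b → ε (a ⊕ b) ≋ ε a +ᴹ ε b
      ε-*    : ∀ a b → ε (a ⊗ b) ≋ ε a *ᴹ ε b
      ε-1    : ε 𝟙 ≋ 1ᴹ
      ε-deg  : ∀ {a d} → HasDeg R deg a (suc d) → ε a ≋ 0ᴹ

    ε-𝟘 : ε 𝟘 ≋ 0ᴹ
    ε-𝟘 = ε-deg (deg-𝟘 1)

    ε-positive : ∀ {a n} → HasDeg R deg a n → 1 ≤ n → ε a ≋ 0ᴹ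
    ε-positive h (s≤s _) = ε-deg h

    ε-⊖ : ∀ a → ε (⊖ a) ≋ -ᴹ ε a
    ε-⊖ a = +ᴹ-inverseˡ-unique (ε (⊖ a)) (ε a)
      (≋-trans (≋-sym (ε-+ (⊖ a) a)) (≋-trans (ε-cong (⊖-inverseˡ a)) ε-𝟘))

    Ker : Tm R S → Set ℓf
    Ker a = ε a ≋ 0ᴹ

    Ker-resp : ∀ {a b} → a ≃ b → Ker b → Ker a
    Ker-resp a≃b b∈K = ≋-trans (ε-cong a≃b) b∈K

    Ker-⊕ : ∀ {a b} → Ker a → Ker b → Ker (a ⊕ b)
    Ker-⊕ {a} {b} a∈K b∈K = begin
      ε (a ⊕ b)    ≈⟨ ε-+ a b ⟩
      ε a +ᴹ ε b   ≈⟨ +ᴹ-cong a∈K b∈K ⟩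
      0ᴹ +ᴹ 0ᴹ     ≈⟨ +ᴹ-identityˡ 0ᴹ ⟩
      0ᴹ           ∎
      where open SetoidReasoning ≋-setoid

    Ker-⊗ˡ : ∀ {a} b → Ker a → Ker (a ⊗ b)
    Ker-⊗ˡ {a} b a∈K = ≋-trans (ε-* a b) (≋-trans (*ᴹ-cong a∈K ≋-refl) (*ᴹ-zeroˡ (ε b)))

    Ker-⊗ʳ : ∀ a {b} → Ker b → Ker (a ⊗ b)
    Ker-⊗ʳ a {b} b∈K = ≋-trans (ε-* a b) (≋-trans (*ᴹ-cong ≋-refl b∈K) (*ᴹ-zeroʳ (ε a)))

    Ker-cancelʳ : ∀ {a b} → Ker (a ⊕ b) → Ker b → Ker a
    Ker-cancelʳ {a} {b} a⊕b∈K = A+B≋0∧B≋0⇒A≋0 (≋-trans (≋-sym (ε-+ a b)) a⊕b∈K)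

  pullback : ∀ {s t} {S : Set s} {T : Set t} {degS : S → ℕ} {degT : T → ℕ}
             {φ : Tm R S → Tm R T} {ε : Tm R T → M} →
             IsGradedTmHom degS degT φ → IsGradedHom degT ε → IsGradedHom degS (ε ∘ φ)
  pullback {φ = φ} {ε} φ-hom ε-hom = record
    { ε-cong = ε-cong ∘ φ-cong
    ; ε-+    = λ a b → ≋-trans (ε-cong (φ-⊕ a b)) (ε-+ (φ a) (φ b))
    ; ε-*    = λ a b → ≋-trans (ε-cong (φ-⊗ a b)) (ε-* (φ a) (φ b))
    ; ε-1    = ≋-trans (ε-cong φ-𝟙) ε-1
    ; ε-deg  = ε-deg ∘ φ-deg
    }
    where
    open IsGradedTmHom φ-hom
    open IsGradedHom ε-hom

  ≋-from-generators : ∀ {s} {S : Set s} {deg : S → ℕ} {ε ε′ : Tm R S → M} →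
                      IsGradedHom deg ε → IsGradedHom deg ε′ →
                      (∀ x → ε (cst x) ≋ ε′ (cst x)) → (∀ g → ε (gen g) ≋ ε′ (gen g)) →
                      ∀ a → ε a ≋ ε′ a
  ≋-from-generators {ε = ε} {ε′} hom hom′ on-cst on-gen = go
    where
    module E  = IsGradedHom hom
    module E′ = IsGradedHom hom′
    open SetoidReasoning ≋-setoid

    go : ∀ a → ε a ≋ ε′ a
    go (cst x) = on-cst x
    go (gen g) = on-gen g
    go (a ⊕ b) = begin
      ε (a ⊕ b)      ≈⟨ E.ε-+ a b ⟩
      ε a +ᴹ ε b     ≈⟨ +ᴹ-cong (go a) (go b) ⟩
      ε′ a +ᴹ ε′ b   ≈⟨ E′.ε-+ a b ⟨
      ε′ (a ⊕ b)     ∎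
    go (a ⊗ b) = begin
      ε (a ⊗ b)      ≈⟨ E.ε-* a b ⟩
      ε a *ᴹ ε b     ≈⟨ *ᴹ-cong (go a) (go b) ⟩
      ε′ a *ᴹ ε′ b   ≈⟨ E′.ε-* a b ⟨
      ε′ (a ⊗ b)     ∎
    go (⊖ a)   = begin
      ε (⊖ a)        ≈⟨ E.ε-⊖ a ⟩
      -ᴹ ε a         ≈⟨ -ᴹ-cong (go a) ⟩
      -ᴹ ε′ a        ≈⟨ E′.ε-⊖ a ⟨
      ε′ (⊖ a)       ∎
    go 𝟘       = ≋-trans E.ε-𝟘 (≋-sym E′.ε-𝟘)
    go 𝟙       = ≋-trans E.ε-1 (≋-sym E′.ε-1)

  IsRep⇒IsGradedHom : ∀ {s} {S : Set s} {deg : S → ℕ} {∂ : Tm R S → Tm R S} {ε : Tm R S → M} →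
                      IsRep R F r deg ∂ ε → IsGradedHom deg ε
  IsRep⇒IsGradedHom ρ = record { IsRep ρ }

  -- The Leibniz rule needs a homogeneous left factor, so ∂ (a ⊗ b) is handled by induction
  -- on a, whose leaves are homogeneous.
  module _ {s} {S : Set s} {deg : S → ℕ} {∂ : Tm R S → Tm R S} (D : IsDifferential R deg ∂)
           {ε : Tm R S → M} (hom : IsGradedHom deg ε) where
    open IsDifferential D
    open IsGradedHom hom

    ∂-Ker-deg0 : ∀ {a} → HasDeg R deg a 0 → Ker (∂ a)
    ∂-Ker-deg0 h = Ker-resp (∂-deg0 h) ε-𝟘

    ∂-Ker-homogeneous-⊗ : ∀ {a d} → HasDeg R deg a d → Ker (∂ a) → ∀ {b} → Ker (∂ b) →
                          Ker (∂ (a ⊗ b))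
    ∂-Ker-homogeneous-⊗ {a} h ∂a∈K {b} ∂b∈K =
      Ker-resp (∂-leibniz h b) (Ker-⊕ (Ker-⊗ˡ b ∂a∈K) (Ker-⊗ʳ _ (Ker-⊗ʳ a ∂b∈K)))

    module _ (∂-gen : ∀ g → Ker (∂ (gen g))) where
      ∂-Ker-⊗ : ∀ a {b} → Ker (∂ b) → Ker (∂ (a ⊗ b))
      ∂-Ker-⊗ (cst x) = ∂-Ker-homogeneous-⊗ (deg-cst x) (∂-Ker-deg0 (deg-cst x))
      ∂-Ker-⊗ (gen g) = ∂-Ker-homogeneous-⊗ (deg-gen g) (∂-gen g)
      ∂-Ker-⊗ 𝟘       = ∂-Ker-homogeneous-⊗ (deg-𝟘 0) (∂-Ker-deg0 (deg-𝟘 0))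
      ∂-Ker-⊗ 𝟙       = ∂-Ker-homogeneous-⊗ deg-𝟙 (∂-Ker-deg0 deg-𝟙)
      ∂-Ker-⊗ (a ⊕ a′) {b} ∂b∈K =
        Ker-resp (≈-trans (∂-cong (distribʳ b a a′)) (∂-+ _ _))
                 (Ker-⊕ (∂-Ker-⊗ a ∂b∈K) (∂-Ker-⊗ a′ ∂b∈K))
      ∂-Ker-⊗ (a ⊗ a′) {b} ∂b∈K =
        Ker-resp (∂-cong (⊗-assoc a a′ b)) (∂-Ker-⊗ a (∂-Ker-⊗ a′ ∂b∈K))
      ∂-Ker-⊗ (⊖ a) {b} ∂b∈K =
        Ker-cancelʳ (Ker-resp ∂-sum≃∂-𝟘⊗b (∂-Ker-⊗ 𝟘 ∂b∈K)) (∂-Ker-⊗ a ∂b∈K)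
        where
        ∂-sum≃∂-𝟘⊗b : ∂ ((⊖ a) ⊗ b) ⊕ ∂ (a ⊗ b) ≃ ∂ (𝟘 ⊗ b)
        ∂-sum≃∂-𝟘⊗b = ≈-trans (≈-sym (∂-+ _ _))
          (∂-cong (≈-trans (≈-sym (distribʳ b (⊖ a) a)) (⊗-cong (⊖-inverseˡ a) ≈-refl)))

      ∂-Ker : ∀ a → Ker (∂ a)
      ∂-Ker a = Ker-resp (∂-cong (≈-sym (⊗-identityʳ a))) (∂-Ker-⊗ a (∂-Ker-deg0 deg-𝟙))

      IsGradedHom⇒IsRep : IsRep R F r deg ∂ ε
      IsGradedHom⇒IsRep = record { IsGradedHom hom; ε-∂ = ∂-Ker }

  module Stabilization {s} {S : Set s} {deg : S → ℕ} {dx : ℕ}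
                       {∂ : Tm R S → Tm R S} {∂⁺ : Tm R (S ⊎ XY R) → Tm R (S ⊎ XY R)}
                       (D : IsDifferential R deg ∂) (St : IsStabilization R deg dx ∂ ∂⁺) where
    open IsStabilization St

    i*-isRep : ∀ {ε} → IsRep R F r (deg⁺ R deg dx) ∂⁺ ε → IsRep R F r deg ∂ (ε ∘ incl R)
    i*-isRep {ε} ρ = IsGradedHom⇒IsRep D (pullback incl-isGradedTmHom (IsRep⇒IsGradedHom ρ)) ∂-gen
      where
      open IsRep ρ
      ∂-gen : ∀ g → ε (incl R (∂ (gen g))) ≋ 0ᴹ
      ∂-gen g = ≋-trans (ε-cong (≈-sym (∂⁺-S g))) (ε-∂ _)

    π*-isRep : ∀ {ε} → IsRep R F r deg ∂ ε → IsRep R F r (deg⁺ R deg dx) ∂⁺ (ε ∘ proj R)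
    π*-isRep {ε} ρ = IsGradedHom⇒IsRep isDifferential⁺ π*hom ∂⁺-gen
      where
      open IsRep ρ using (ε-∂)
      hom : IsGradedHom deg ε
      hom = IsRep⇒IsGradedHom ρ
      π*hom : IsGradedHom (deg⁺ R deg dx) (ε ∘ proj R)
      π*hom = pullback proj-isGradedTmHom hom
      open IsGradedHom π*hom using (ε-cong; ε-𝟘)
      ∂⁺-gen : ∀ g → ε (proj R (∂⁺ (gen g))) ≋ 0ᴹ
      ∂⁺-gen (inj₁ g) = ≋-trans (ε-cong (∂⁺-S g))
        (≡.subst (λ t → ε t ≋ 0ᴹ) (≡.sym (proj∘incl≗id (∂ (gen g)))) (ε-∂ _))
      ∂⁺-gen (inj₂ gx) = ≋-trans (ε-cong ∂⁺-x) ε-𝟘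
      ∂⁺-gen (inj₂ gy) = ≋-trans (ε-cong ∂⁺-y) ε-𝟘

    i*∘π*≋id : ∀ (ε : Tm R S → M) a → ε (proj R (incl R a)) ≋ ε a
    i*∘π*≋id ε a = ≋-reflexive (≡.cong ε (proj∘incl≗id a))

    -- Only here is positivity needed: x and y must be killed by ε, as they are by π.
    π*∘i*≋id : (∀ g → 1 ≤ deg⁺ R deg dx g) →
               ∀ {ε} → IsRep R F r (deg⁺ R deg dx) ∂⁺ ε → ∀ a → ε (incl R (proj R a)) ≋ ε a
    π*∘i*≋id pos {ε} ρ = ≋-from-generators π*i*hom hom (λ _ → ≋-refl) on-gen
      where
      hom : IsGradedHom (deg⁺ R deg dx) ε
      hom = IsRep⇒IsGradedHom ρ
      π*i*hom : IsGradedHom (deg⁺ R deg dx) (ε ∘ incl R ∘ proj R)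
      π*i*hom = pullback proj-isGradedTmHom (pullback incl-isGradedTmHom hom)
      open IsGradedHom hom using (ε-𝟘; ε-positive)
      on-gen : ∀ g → ε (incl R (proj R (gen g))) ≋ ε (gen g)
      on-gen (inj₁ g) = ≋-refl
      on-gen (inj₂ t) = ≋-trans ε-𝟘 (≋-sym (ε-positive (deg-gen (inj₂ t)) (pos (inj₂ t))))

open Representations

proposition2p3 : ∀ {c ℓ s : Level} (R : Ring c ℓ) (S : Set s) (deg : S → ℕ) (dx : ℕ)
                 (∂ : Tm R S → Tm R S) (∂⁺ : Tm R (S ⊎ XY R) → Tm R (S ⊎ XY R)) →
                 IsDifferential R deg ∂ →
                 IsStabilization R deg dx ∂ ∂⁺ →
                 (∀ g → 1 ≤ deg⁺ R deg dx g) →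
                 ∀ (r : ℕ) → 1 ≤ r → ∀ {f ℓf : Level} (F : Field f ℓf) →
                 StabRepBijection R F r deg dx ∂ ∂⁺
proposition2p3 R S deg dx ∂ ∂⁺ D St pos r _ F = record
  { i*-rep  = λ _ → i*-isRep
  ; π*-rep  = λ _ → π*-isRep
  ; i*π*≡id = λ ε _ → i*∘π*≋id ε
  ; π*i*≡id = λ _ → π*∘i*≋id pos
  }
  where open Stabilization R F r D St
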